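{- Let $G=(V,E)$ be a finite simple graph and let $S\subseteq V$ (the set of vertices chosen by a feasible solution of a relaxation of the fort covering program obtained by omitting fort constraints). Consider the integer program \[\min\sum_{v\in V}x_v\] subject to \[\sum_{v\in V}x_v\ge 1,\] \[x_w-x_v+\sum_{a\in N(w)\setminus\{v\}}x_a\ge 0\quad\text{for all pairs }(v,w)\text{ with }v\in V,\ w\in N(v),\] \[x_v=0\quad\forall v\in \mathrm{cl}(S),\qquad x\in\{0,1\}^V.\] Then this program finds a minimum size violated fort with respect to $S$: an optimal solution is the indicator vector of a fort $B$ of $G$ containing no vertex of $S$, of minimum cardinality among all such forts.
   Context: $N(w)$ denotes the set of neighbors of $w$. A fort of $G$ is a nonempty set $F\subseteq V$ such that no vertex outside $F$ is adjacent to exactly one vertex in $F$. A fort is violated with respect to $S$ if it contains no vertex of $S$. Zero forcing color change rule: a colored vertex with exactly one uncolored neighbor forces that neighbor to become colored; $\mathrm{cl}(S)$ is the set of colored vertices obtained by starting with exactly $S$ colored and applying the rule until no further vertex can be forced. The fort covering program is $\min\sum_{v}s_v$ subject to $\sum_{v\in B}s_v\ge1$ for every fort $B$, $s\in\{0,1\}^V$. -}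

module Defs where

open import Data.Nat using (ℕ; zero; suc; _+_; _≤_)
open import Data.Bool using (Bool; true; false; if_then_else_; _∧_; not)
open import Data.Fin using (Fin; zero; suc; _≟_)
open import Data.Product using (Σ; ∃; _×_)
open import Relation.Nullary using (¬_)
open import Relation.Nullary.Decidable using (⌊_⌋)
open import Relation.Binary.PropositionalEquality using (_≡_; _≢_)

record Graph (n : ℕ) : Set where
  field
    adj   : Fin n → Fin n → Bool
    sym   : ∀ u v → adj u v ≡ adj v u
    irrefl : ∀ v → adj v v ≡ false
open Graph public

Σᵥ : ∀ {n} → (Fin n → ℕ) → ℕ
Σᵥ {zero}  f = 0
Σᵥ {suc n} f = f zero + Σᵥ (λ i → f (suc i))

val : Bool → ℕ
val b = if b then 1 else 0

-- Subsets of V (and 0/1 vectors x ∈ {0,1}^V) are Boolean functions.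
Subset : ℕ → Set
Subset n = Fin n → Bool

size : ∀ {n} → Subset n → ℕ
size x = Σᵥ (λ v → val (x v))

nbrsIn : ∀ {n} → Graph n → Subset n → Fin n → ℕ
nbrsIn G F u = Σᵥ (λ a → val (adj G u a ∧ F a))

IsFort : ∀ {n} → Graph n → Subset n → Set
IsFort G F = (∃ λ v → F v ≡ true)
           × (∀ u → F u ≡ false → nbrsIn G F u ≢ 1)

Violated : ∀ {n} → Subset n → Subset n → Set
Violated S F = ∀ v → S v ≡ true → F v ≡ false

-- Zero forcing closure cl(S): least set containing S and closed under the
-- colour change rule (a coloured u all of whose neighbours other than v are
-- coloured forces its neighbour v).
data InCl {n} (G : Graph n) (S : Subset n) : Fin n → Set where
  base  : ∀ {v} → S v ≡ true → InCl G S v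
  force : ∀ {u v} → InCl G S u → adj G u v ≡ true
        → (∀ w → adj G u w ≡ true → w ≢ v → InCl G S w)
        → InCl G S v

-- Feasibility for the integer program of Theorem 6 (x ∈ {0,1}^V).
-- The constraint x_w - x_v + Σ_{a ∈ N(w)∖{v}} x_a ≥ 0 is written in ℕ as
-- x_v ≤ x_w + Σ_{a ∈ N(w)∖{v}} x_a.
Feasible : ∀ {n} → Graph n → Subset n → Subset n → Set
Feasible G S x =
    (1 ≤ size x)
  × (∀ v w → adj G v w ≡ true →
       val (x v) ≤ val (x w) + Σᵥ (λ a → val (adj G w a ∧ not ⌊ a ≟ v ⌋ ∧ x a)))
  × (∀ v → InCl G S v → x v ≡ false)

Optimal : ∀ {n} → Graph n → Subset n → Subset n → Set
Optimal G S x = Feasible G S x × (∀ y → Feasible G S y → size x ≤ size y)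

module Submission where

-- The proof rests on one identity: for vertices v, w
-- the neighbour count of w in x splits as the contribution of v plus the
-- punctured count Σ_{a ∈ N(w)∖{v}} x_a appearing in the constraints.

open import Defs hiding (sym)
open import Data.Nat using (ℕ; zero; suc; _+_; _≤_; z≤n; s≤s)
open import Data.Nat.Properties
  using (m≤m+n; m≤n+m; ≤-trans; ≤-reflexive; 1+n≰n; n≢0⇒n>0;
         +-commutativeSemigroup; suc-injective)
open import Algebra.Properties.CommutativeSemigroup +-commutativeSemigroup
  using (x∙yz≈y∙xz)
open import Data.Bool using (Bool; true; false; _∧_; not)
open import Data.Fin using (Fin; zero; suc; _≟_)
import Data.Fin.Properties as Fin
open import Data.Product using (∃; _×_; _,_; proj₁; proj₂)
open import Data.Empty using (⊥-elim)
open import Relation.Nullary using (Dec; yes; no)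
open import Relation.Nullary.Decidable using (⌊_⌋)
open import Relation.Binary.PropositionalEquality
  using (_≡_; _≢_; refl; sym; trans; cong; cong₂; subst; subst₂; module ≡-Reasoning)

Σᵥ-cong : ∀ {n} {f g : Fin n → ℕ} → (∀ a → f a ≡ g a) → Σᵥ f ≡ Σᵥ g
Σᵥ-cong {zero}  eq = refl
Σᵥ-cong {suc n} eq = cong₂ _+_ (eq zero) (Σᵥ-cong (λ i → eq (suc i)))

Σᵥ-split : ∀ {n} (f g : Fin n → ℕ) (v : Fin n) →
           g v ≡ 0 → (∀ a → a ≢ v → g a ≡ f a) → Σᵥ f ≡ f v + Σᵥ g
Σᵥ-split f g zero gv≡0 off-v rewrite gv≡0 =
  cong (f zero +_) (Σᵥ-cong (λ i → sym (off-v (suc i) (λ ()))))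
Σᵥ-split f g (suc v) gv≡0 off-v = begin
  f zero + Σᵥ (λ i → f (suc i))
    ≡⟨ cong (f zero +_) (Σᵥ-split (λ i → f (suc i)) (λ i → g (suc i)) v gv≡0
                           (λ i i≢v → off-v (suc i) (λ eq → i≢v (Fin.suc-injective eq)))) ⟩
  f zero + (f (suc v) + Σᵥ (λ i → g (suc i)))
    ≡⟨ x∙yz≈y∙xz (f zero) (f (suc v)) _ ⟩
  f (suc v) + (f zero + Σᵥ (λ i → g (suc i)))
    ≡⟨ cong (λ t → f (suc v) + (t + Σᵥ (λ i → g (suc i)))) (sym (off-v zero (λ ()))) ⟩
  f (suc v) + Σᵥ g
    ∎
  where open ≡-Reasoning

Σᵥ-zero : ∀ {n} (f : Fin n → ℕ) → (∀ a → f a ≡ 0) → Σᵥ f ≡ 0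
Σᵥ-zero {zero}  f eq = refl
Σᵥ-zero {suc n} f eq rewrite eq zero = Σᵥ-zero (λ i → f (suc i)) (λ i → eq (suc i))

term≤Σᵥ : ∀ {n} (f : Fin n → ℕ) (a : Fin n) → f a ≤ Σᵥ f
term≤Σᵥ f zero    = m≤m+n (f zero) _
term≤Σᵥ f (suc a) = ≤-trans (term≤Σᵥ (λ i → f (suc i)) a) (m≤n+m _ (f zero))

Σᵥ-positive : ∀ {n} (f : Fin n → ℕ) → 1 ≤ Σᵥ f → ∃ λ a → 1 ≤ f a
Σᵥ-positive {zero}  f ()
Σᵥ-positive {suc n} f pos with f zero in eq
... | suc _ = zero , subst (1 ≤_) (sym eq) (s≤s z≤n)
... | zero with Σᵥ-positive (λ i → f (suc i)) pos
...   | a , fa = suc a , fa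

val-positive : ∀ {b} → 1 ≤ val b → b ≡ true
val-positive {true} _ = refl

val-∧-positive : ∀ {p r} → 1 ≤ val (p ∧ r) → p ≡ true × r ≡ true
val-∧-positive {true} {true} _ = refl , refl

puncture-at : ∀ {n} (p : Bool) {a v : Fin n} (d : Dec (a ≡ v)) (r : Bool) → a ≡ v →
              val (p ∧ not ⌊ d ⌋ ∧ r) ≡ 0
puncture-at true  (yes _) r _ = refl
puncture-at false (yes _) r _ = refl
puncture-at p (no a≢v) r a≡v = ⊥-elim (a≢v a≡v)

puncture-off : ∀ {n} (p : Bool) {a v : Fin n} (d : Dec (a ≡ v)) (r : Bool) → a ≢ v →
               val (p ∧ not ⌊ d ⌋ ∧ r) ≡ val (p ∧ r)
puncture-off p (yes a≡v) r a≢v = ⊥-elim (a≢v a≡v)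
puncture-off true  (no _) r _ = refl
puncture-off false (no _) r _ = refl

nbrsExcept : ∀ {n} → Graph n → Subset n → Fin n → Fin n → ℕ
nbrsExcept G x w v = Σᵥ (λ a → val (adj G w a ∧ not ⌊ a ≟ v ⌋ ∧ x a))

nbrsIn-split : ∀ {n} (G : Graph n) (x : Subset n) (w v : Fin n) →
               nbrsIn G x w ≡ val (adj G w v ∧ x v) + nbrsExcept G x w v
nbrsIn-split G x w v =
  Σᵥ-split _ _ v (puncture-at (adj G w v) (v ≟ v) (x v) refl)
                 (λ a a≢v → puncture-off (adj G w a) (a ≟ v) (x a) a≢v)

nbrsIn-through : ∀ {n} (G : Graph n) (x : Subset n) {w v : Fin n} →
                 adj G w v ≡ true → x v ≡ true →
                 nbrsIn G x w ≡ suc (nbrsExcept G x w v)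
nbrsIn-through G x {w} {v} wv xv =
  trans (nbrsIn-split G x w v) (cong (_+ nbrsExcept G x w v) (cong₂ (λ p r → val (p ∧ r)) wv xv))

adj-flip : ∀ {n} (G : Graph n) {u v : Fin n} → adj G u v ≡ true → adj G v u ≡ true
adj-flip G {u} {v} uv = trans (Graph.sym G v u) uv

-- Every feasible solution is a fort: it is nonempty by Σ x ≥ 1, and a vertex
-- u ∉ x with a unique neighbour a ∈ x makes the constraint for (a, u) read 1 ≤ 0.
feasible⇒fort : ∀ {n} (G : Graph n) (S x : Subset n) → Feasible G S x → IsFort G x
feasible⇒fort G S x (size≥1 , constraint , _) = nonempty , no-unique-neighbour
  where
  nonempty : ∃ λ v → x v ≡ true
  nonempty with Σᵥ-positive _ size≥1
  ... | v , xv = v , val-positive xv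

  no-unique-neighbour : ∀ u → x u ≡ false → nbrsIn G x u ≢ 1
  no-unique-neighbour u xu count≡1
    with Σᵥ-positive _ (≤-reflexive (sym count≡1))
  ... | a , ua∧xa with val-∧-positive ua∧xa
  ...   | ua , xa = 1+n≰n (subst₂ _≤_ (cong val xa) (cong₂ _+_ (cong val xu) others≡0)
                                  (constraint a u (adj-flip G ua)))
    where
    others≡0 : nbrsExcept G x u a ≡ 0
    others≡0 = suc-injective (trans (sym (nbrsIn-through G x ua xa)) count≡1)

-- A fort B containing no vertex of S is disjoint from cl(S): if a vertex u of
-- cl(S) forces v ∈ B, then u ∉ B and v is the only neighbour of u in B.
violated-fort-avoids-closure : ∀ {n} (G : Graph n) (S B : Subset n) →
  IsFort G B → Violated S B → ∀ v → InCl G S v → B v ≡ false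
violated-fort-avoids-closure G S B fort violated = avoids
  where
  avoids : ∀ v → InCl G S v → B v ≡ false
  avoids v (base sv) = violated v sv
  avoids v (force {u} cu uv others) with B v in bv
  ... | false = refl
  ... | true  = ⊥-elim (proj₂ fort u (avoids u cu)
                          (trans (nbrsIn-through G B uv bv) (cong suc (Σᵥ-zero _ term≡0))))
    where
    term≡0 : ∀ a → val (adj G u a ∧ not ⌊ a ≟ v ⌋ ∧ B a) ≡ 0
    term≡0 a with adj G u a in ua
    ... | false = refl
    ... | true with a ≟ v
    ...   | yes _   = refl
    ...   | no a≢v rewrite avoids a (others a ua a≢v) = refl

-- Every fort containing no vertex of S is feasible: the constraint for (v, w)
-- with v ∈ B and w ∉ B is the fort condition at w.
violated-fort⇒feasible : ∀ {n} (G : Graph n) (S B : Subset n) →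
  IsFort G B → Violated S B → Feasible G S B
violated-fort⇒feasible G S B fort violated =
  size≥1 , constraint , violated-fort-avoids-closure G S B fort violated
  where
  size≥1 : 1 ≤ size B
  size≥1 with proj₁ fort
  ... | v , bv = subst (_≤ size B) (cong val bv) (term≤Σᵥ (λ a → val (B a)) v)

  constraint : ∀ v w → adj G v w ≡ true → val (B v) ≤ val (B w) + nbrsExcept G B w v
  constraint v w vw with B v in bv | B w in bw
  ... | false | _     = z≤n
  ... | true  | true  = s≤s z≤n
  ... | true  | false = n≢0⇒n>0 λ others≡0 →
    proj₂ fort w bw (trans (nbrsIn-through G B (adj-flip G vw) bv) (cong suc others≡0))

-- Theorem 6: an optimal solution x is a fort containing no vertex of S (these
-- lie in cl(S), where x vanishes), and it is no larger than any such fort,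
-- every such fort being feasible.
theorem6 : ∀ {n} (G : Graph n) (S x : Subset n) → Optimal G S x →
    IsFort G x × Violated S x
      × (∀ B → IsFort G B → Violated S B → size x ≤ size B)
theorem6 G S x (feasible , optimal) =
    feasible⇒fort G S x feasible
  , (λ v sv → proj₂ (proj₂ feasible) v (base sv))
  , (λ B fort violated → optimal B (violated-fort⇒feasible G S B fort violated))
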